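{- For every finite strict double poset $d$ and every permutation $\Pi\in\mathfrak S(N)$, $$\#\mathrm{Mor}(d,\iota(\Pi))=\sum_{\sigma\in\mathfrak S}|\mathrm{Epi}(d,\iota(\sigma))|\cdot\#\{A\subseteq[N]:\mathrm{std}(\Pi|_A)=\sigma\}.$$
   Context: A finite strict double poset is a triple $(A,P_A,Q_A)$ with $A$ finite and $P_A,Q_A$ strict partial orders; morphisms are maps $f$ with $(x,y)\in P_A\Rightarrow(f(x),f(y))\in P_B$ and likewise for $Q$, forming a category; $\mathrm{Mor}$ is the set of morphisms and $\mathrm{Epi}$ the set of epimorphisms. $\mathfrak S=\bigcup_n\mathfrak S(n)$ is the set of all permutations; for $\sigma\in\mathfrak S(n)$, $\iota(\sigma)=([n],\{(i,j):i<j\},\{(i,j):\sigma(i)<\sigma(j)\})$. For $A=\{a_1<\dots<a_k\}\subseteq[N]$, $\mathrm{std}(\Pi|_A)\in\mathfrak S(k)$ is the permutation $\tau$ with $\tau(i)<\tau(j)\iff\Pi(a_i)<\Pi(a_j)$; thus $\#\{A:\mathrm{std}(\Pi|_A)=\sigma\}$ is the number of occurrences of the pattern $\sigma$ in $\Pi$. -}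

module Defs where

open import Level using (0ℓ)
open import Data.Nat as ℕ using (ℕ; zero; suc; _+_; _*_)
open import Data.Fin as Fin using (Fin; zero; suc; _<_)
open import Data.Fin.Properties using (all?; any?; _≟_; _<?_; <-isStrictPartialOrder; <-irrefl; <-trans)
open import Data.List using (List; []; _∷_; [_]; length; filter; concatMap; map; upTo)
open import Data.Nat.ListAction using (sum)
open import Data.Product using (Σ; ∃; _,_; proj₁; proj₂; _×_)
open import Data.Vec.Functional using (Vector) renaming (_∷_ to _∷ᶠ_)
open import Function.Definitions using (Injective)
open import Relation.Binary using (Rel; IsStrictPartialOrder; Decidable)
open import Relation.Binary.PropositionalEquality using (_≡_; refl; cong; subst; sym; isEquivalence)
open import Relation.Nullary using (Dec; yes; no; ¬_)
open import Relation.Nullary.Decidable using (_→-dec_; _×-dec_)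
open import Relation.Unary using (Pred)
import Relation.Unary as U

record DoublePoset : Set₁ where
  field
    size  : ℕ
    P     : Rel (Fin size) 0ℓ
    Q     : Rel (Fin size) 0ℓ
    P-spo : IsStrictPartialOrder _≡_ P
    Q-spo : IsStrictPartialOrder _≡_ Q
    P?    : Decidable P
    Q?    : Decidable Q
open DoublePoset public

IsMorphism : (d e : DoublePoset) → (Fin (size d) → Fin (size e)) → Set
IsMorphism d e f =
  (∀ x y → P d x y → P e (f x) (f y)) × (∀ x y → Q d x y → Q e (f x) (f y))

isMorphism? : (d e : DoublePoset) → U.Decidable (IsMorphism d e)
isMorphism? d e f =
  (all? λ x → all? λ y → P? d x y →-dec P? e (f x) (f y)) ×-dec
  (all? λ x → all? λ y → Q? d x y →-dec Q? e (f x) (f y))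

IsEpi : (d e : DoublePoset) → (Fin (size d) → Fin (size e)) → Set
IsEpi d e f = IsMorphism d e f × (∀ y → ∃ λ x → f x ≡ y)

isEpi? : (d e : DoublePoset) → U.Decidable (IsEpi d e)
isEpi? d e f = isMorphism? d e f ×-dec (all? λ y → any? λ x → f x ≟ y)

allFuns : ∀ n m → List (Fin n → Fin m)
allFuns zero    m = [ (λ ()) ]
allFuns (suc n) m =
  concatMap (λ f → map (λ y → y ∷ᶠ f) (Data.List.allFin m)) (allFuns n m)
  where import Data.List

count : ∀ {A : Set} {P : Pred A 0ℓ} → U.Decidable P → List A → ℕ
count P? xs = length (filter P? xs)

#Mor : DoublePoset → DoublePoset → ℕ
#Mor d e = count (isMorphism? d e) (allFuns (size d) (size e))

#Epi : DoublePoset → DoublePoset → ℕ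
#Epi d e = count (isEpi? d e) (allFuns (size d) (size e))

-- Permutations of [k] = injective (hence bijective) maps Fin k → Fin k

Perm : ℕ → Set
Perm k = Σ (Fin k → Fin k) Injective'
  where Injective' : (Fin k → Fin k) → Set
        Injective' f = Injective _≡_ _≡_ f

injective? : ∀ {k} (f : Fin k → Fin k) → Dec (Injective _≡_ _≡_ f)
injective? f with all? (λ x → all? (λ y → (f x ≟ f y) →-dec (x ≟ y)))
... | yes p = yes (λ {x} {y} → p x y)
... | no ¬p = no (λ inj → ¬p (λ x y → inj))

perms : ∀ k → List (Perm k)
perms k = concatMap pick (allFuns k k)
  where
  pick : (Fin k → Fin k) → List (Perm k)
  pick f with injective? f
  ... | yes p = [ (f , p) ]
  ... | no _  = []

pullback-spo : ∀ {k} (g : Fin k → Fin k) →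
               IsStrictPartialOrder _≡_ (λ i j → g i < g j)
pullback-spo g = record
  { isEquivalence = isEquivalence
  ; irrefl = λ { refl gi<gi → <-irrefl refl gi<gi }
  ; trans  = <-trans
  ; <-resp-≈ = (λ { refl p → p }) , (λ { refl p → p })
  }

ι : ∀ {k} → Perm k → DoublePoset
ι {k} (σ , _) = record
  { size  = k
  ; P     = _<_
  ; Q     = λ i j → σ i < σ j
  ; P-spo = <-isStrictPartialOrder
  ; Q-spo = pullback-spo σ
  ; P?    = _<?_
  ; Q?    = λ i j → σ i <? σ j
  }

-- Pattern occurrences.  A subset A = {a₁ < … < a_k} ⊆ [N] is given by
-- its increasing enumeration a : Fin k → Fin N (strictly increasing).

StrictlyIncreasing : ∀ {k N} → (Fin k → Fin N) → Set
StrictlyIncreasing a = ∀ i j → i < j → a i < a j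

StdIs : ∀ {N k} → Perm N → (Fin k → Fin N) → Perm k → Set
StdIs (Π , _) a (σ , _) =
  ∀ i j → (σ i < σ j → Π (a i) < Π (a j)) × (Π (a i) < Π (a j) → σ i < σ j)

IsOccurrence : ∀ {N k} → Perm N → Perm k → (Fin k → Fin N) → Set
IsOccurrence Π σ a = StrictlyIncreasing a × StdIs Π a σ

isOccurrence? : ∀ {N k} (Π : Perm N) (σ : Perm k) → U.Decidable (IsOccurrence Π σ)
isOccurrence? (Π , _) (σ , _) a =
  (all? λ i → all? λ j → (i <? j) →-dec (a i <? a j)) ×-dec
  (all? λ i → all? λ j →
     ((σ i <? σ j) →-dec (Π (a i) <? Π (a j))) ×-dec
     ((Π (a i) <? Π (a j)) →-dec (σ i <? σ j)))

#Occ : ∀ {N k} → Perm N → Perm k → ℕ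
#Occ {N} {k} Π σ = count (isOccurrence? Π σ) (allFuns k N)

-- Partial sum of  Σ_{σ ∈ 𝔖} |Epi(d, ι σ)| · #Occ(Π, σ)  over σ ∈ 𝔖(k), k ≤ K

termsOfSize : DoublePoset → ∀ {N} → Perm N → ℕ → ℕ
termsOfSize d Π k = sum (map (λ σ → #Epi d (ι σ) * #Occ Π σ) (perms k))

partialSum : DoublePoset → ∀ {N} → Perm N → ℕ → ℕ
partialSum d Π K = sum (map (termsOfSize d Π) (upTo (suc K)))

{-# OPTIONS --safe #-}
module Submission where

-- Every map f : [n] → [N] factors uniquely as a surjection g : [n] → [k] followed by a
-- strictly increasing a : [k] → [N] (the enumeration of its image); necessarily k ≤ n,
-- so the partial sums are constant from K = n = |d| on.  Such a pair gives a morphism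
-- a ∘ g : d → ι(Π) exactly when g is an epimorphism d → ι(σ) and a is an occurrence
-- of σ in Π, for the unique permutation σ = std(Π ∘ a) ordered like Π ∘ a.  So both
-- sides count the same triples (k , g , a).

open import Algebra.Properties.CommutativeSemigroup using (interchange)
open import Data.Fin as Fin using (Fin; zero; suc; _<_; punchOut)
open import Data.Fin.Properties
  using ( all?; any?; _≟_; _<?_; 0≢1+n; <-cmp; <-irrefl; <-asym; <⇒≢; ≤-refl; ≤-antisym
        ; injective⇒≤; punchOut-injective)
open import Data.List using (List; []; _∷_; _++_; map; concatMap; allFin; upTo; filter; length; lookup)
open import Data.List.Membership.Propositional using (_∈_)
open import Data.List.Membership.Propositional.Properties
  using (∈-allFin; ∈-upTo⁺; ∈-filter⁺; ∈-filter⁻; ∈-lookup)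
open import Data.List.Properties using (map-∘; map-++)
open import Data.List.Relation.Unary.All as All using (All; []; _∷_)
open import Data.List.Relation.Unary.AllPairs using (AllPairs; _∷_)
import Data.List.Relation.Unary.AllPairs.Properties as AllPairs
open import Data.List.Relation.Unary.Any using (here; there; index)
open import Data.List.Relation.Unary.Any.Properties using (lookup-index)
open import Data.List.Relation.Unary.Unique.Propositional using (Unique)
open import Data.List.Relation.Unary.Unique.Propositional.Properties using (allFin⁺; upTo⁺)
open import Data.Nat as ℕ using (ℕ; zero; suc; _+_; _*_; _≤_; z<s; s<s; s≤s)
import Data.Nat.Properties as ℕ
open import Data.Nat.ListAction using (sum)
open import Data.Nat.ListAction.Properties using (sum-++)
open import Data.Product using (∃; _×_; _,_; proj₁; proj₂; swap)
open import Data.Vec.Functional using () renaming (_∷_ to _∷ᶠ_)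
open import Function using (_∘_)
open import Function.Definitions using (Injective)
open import Level using (0ℓ)
open import Relation.Binary using (Rel; Decidable; DecidableEquality; tri<; tri≈; tri>)
open import Relation.Binary.PropositionalEquality
open import Relation.Nullary using (Dec; yes; no; ¬_; contradiction)
open import Relation.Nullary.Decidable using (_×-dec_; _→-dec_)
open import Relation.Unary using (Pred; _⊆_)
import Relation.Unary as U

open import Defs

private
  variable
    A B C D : Set
    k n m r r′ N : ℕ

-- Sums and indicators

∑ : List A → (A → ℕ) → ℕ
∑ xs f = sum (map f xs)

∑-syntax : List A → (A → ℕ) → ℕ
∑-syntax = ∑

infix 5 ∑-syntax
syntax ∑-syntax xs (λ x → e) = ∑[ x ∈ xs ] e

∑-cong : ∀ (xs : List A) {f g : A → ℕ} → (∀ x → f x ≡ g x) → ∑ xs f ≡ ∑ xs g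
∑-cong []       f≗g = refl
∑-cong (x ∷ xs) f≗g = cong₂ _+_ (f≗g x) (∑-cong xs f≗g)

∑-zero : ∀ {xs : List A} {f : A → ℕ} → All (λ x → f x ≡ 0) xs → ∑ xs f ≡ 0
∑-zero []            = refl
∑-zero (fx≡0 ∷ f≡0) = cong₂ _+_ fx≡0 (∑-zero f≡0)

∑-+ : ∀ (xs : List A) (f g : A → ℕ) → ∑[ x ∈ xs ] (f x + g x) ≡ ∑ xs f + ∑ xs g
∑-+ []       f g = refl
∑-+ (x ∷ xs) f g =
  trans (cong (f x + g x +_) (∑-+ xs f g)) (interchange ℕ.+-commutativeSemigroup (f x) (g x) (∑ xs f) (∑ xs g))

∑-*ˡ : ∀ c (xs : List A) (f : A → ℕ) → c * ∑ xs f ≡ ∑[ x ∈ xs ] c * f x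
∑-*ˡ c []       f = ℕ.*-zeroʳ c
∑-*ˡ c (x ∷ xs) f = trans (ℕ.*-distribˡ-+ c (f x) (∑ xs f)) (cong (c * f x +_) (∑-*ˡ c xs f))

∑-*ʳ : ∀ c (xs : List A) (f : A → ℕ) → ∑ xs f * c ≡ ∑[ x ∈ xs ] f x * c
∑-*ʳ c []       f = refl
∑-*ʳ c (x ∷ xs) f = trans (ℕ.*-distribʳ-+ c (f x) (∑ xs f)) (cong (f x * c +_) (∑-*ʳ c xs f))

∑-*-∑ : ∀ (xs : List A) (ys : List B) (f : A → ℕ) (g : B → ℕ) →
        ∑ xs f * ∑ ys g ≡ ∑[ x ∈ xs ] ∑[ y ∈ ys ] f x * g y
∑-*-∑ xs ys f g = trans (∑-*ʳ (∑ ys g) xs f) (∑-cong xs λ x → ∑-*ˡ (f x) ys g)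

∑-map : ∀ (h : A → B) (xs : List A) (f : B → ℕ) → ∑ (map h xs) f ≡ ∑ xs (f ∘ h)
∑-map h xs f = cong sum (sym (map-∘ xs))

∑-++ : ∀ (xs ys : List A) (f : A → ℕ) → ∑ (xs ++ ys) f ≡ ∑ xs f + ∑ ys f
∑-++ xs ys f = trans (cong sum (map-++ f xs ys)) (sum-++ (map f xs) (map f ys))

∑-concatMap : ∀ (p : A → List B) (xs : List A) (f : B → ℕ) →
              ∑ (concatMap p xs) f ≡ ∑[ x ∈ xs ] ∑ (p x) f
∑-concatMap p []       f = refl
∑-concatMap p (x ∷ xs) f =
  trans (∑-++ (p x) (concatMap p xs) f) (cong (∑ (p x) f +_) (∑-concatMap p xs f))

∑-comm : ∀ (xs : List A) (ys : List B) (F : A → B → ℕ) →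
         ∑[ x ∈ xs ] ∑[ y ∈ ys ] F x y ≡ ∑[ y ∈ ys ] ∑[ x ∈ xs ] F x y
∑-comm []       ys F = sym (∑-zero (All.universal (λ _ → refl) ys))
∑-comm (x ∷ xs) ys F =
  trans (cong (∑ ys (F x) +_) (∑-comm xs ys F)) (sym (∑-+ ys (F x) λ y → ∑[ x′ ∈ xs ] F x′ y))

∑-comm₃ : ∀ (xs : List A) (ys : List B) (zs : List C) (F : A → B → C → ℕ) →
          ∑[ x ∈ xs ] ∑[ y ∈ ys ] ∑[ z ∈ zs ] F x y z ≡ ∑[ y ∈ ys ] ∑[ z ∈ zs ] ∑[ x ∈ xs ] F x y z
∑-comm₃ xs ys zs F = trans (∑-comm xs ys _) (∑-cong ys λ y → ∑-comm xs zs λ x → F x y)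

⟦_⟧ : Dec A → ℕ
⟦ yes _ ⟧ = 1
⟦ no  _ ⟧ = 0

⟦⟧-yes : A → (a? : Dec A) → ⟦ a? ⟧ ≡ 1
⟦⟧-yes a (yes _) = refl
⟦⟧-yes a (no ¬a) = contradiction a ¬a

⟦⟧-no : ¬ A → (a? : Dec A) → ⟦ a? ⟧ ≡ 0
⟦⟧-no ¬a (yes a) = contradiction a ¬a
⟦⟧-no ¬a (no _)  = refl

⟦⟧-cong : (A → B) → (B → A) → (a? : Dec A) (b? : Dec B) → ⟦ a? ⟧ ≡ ⟦ b? ⟧
⟦⟧-cong to from (yes a) b? = sym (⟦⟧-yes (to a) b?)
⟦⟧-cong to from (no ¬a) b? = sym (⟦⟧-no (¬a ∘ from) b?)

⟦⟧-× : (a? : Dec A) (b? : Dec B) → ⟦ a? ×-dec b? ⟧ ≡ ⟦ a? ⟧ * ⟦ b? ⟧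
⟦⟧-× (yes _) (yes _) = refl
⟦⟧-× (yes _) (no _)  = refl
⟦⟧-× (no _)  _       = refl

count≡∑ : ∀ {P : Pred A 0ℓ} (P? : U.Decidable P) xs → count P? xs ≡ ∑[ x ∈ xs ] ⟦ P? x ⟧
count≡∑ P? []       = refl
count≡∑ P? (x ∷ xs) with P? x
... | yes _ = cong suc (count≡∑ P? xs)
... | no  _ = count≡∑ P? xs

∑-sift : ∀ {_≈_ : Rel A 0ℓ} (_≈?_ : Decidable _≈_) {c} (xs : List A) (h : A → ℕ) →
         (∀ {x} → c ≈ x → h x ≡ h c) → ∑[ x ∈ xs ] ⟦ c ≈? x ⟧ ≡ 1 →
         ∑[ x ∈ xs ] ⟦ c ≈? x ⟧ * h x ≡ h c
∑-sift _≈?_ {c} xs h h-resp once = begin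
  ∑[ x ∈ xs ] ⟦ c ≈? x ⟧ * h x    ≡⟨ ∑-cong xs (λ x → at x (c ≈? x)) ⟩
  ∑[ x ∈ xs ] ⟦ c ≈? x ⟧ * h c    ≡⟨ ∑-*ʳ (h c) xs _ ⟨
  (∑[ x ∈ xs ] ⟦ c ≈? x ⟧) * h c  ≡⟨ cong (_* h c) once ⟩
  1 * h c                         ≡⟨ ℕ.*-identityˡ (h c) ⟩
  h c                             ∎
  where
  open ≡-Reasoning
  at : ∀ x (c≈?x : Dec _) → ⟦ c≈?x ⟧ * h x ≡ ⟦ c≈?x ⟧ * h c
  at x (yes c≈x) = cong (1 *_) (h-resp c≈x)
  at x (no _)    = refl

∑-⟦≟⟧-Unique : ∀ (_≟_ : DecidableEquality A) {x xs} → Unique xs → x ∈ xs →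
               ∑[ y ∈ xs ] ⟦ x ≟ y ⟧ ≡ 1
∑-⟦≟⟧-Unique _≟_ {x} (x∉xs ∷ _) (here refl) =
  cong₂ _+_ (⟦⟧-yes refl (x ≟ x)) (∑-zero (All.map (λ x≢y → ⟦⟧-no x≢y (x ≟ _)) x∉xs))
∑-⟦≟⟧-Unique _≟_ {x} {y ∷ _} (y∉xs ∷ xs!) (there x∈xs) =
  cong₂ _+_ (⟦⟧-no (λ x≡y → All.lookup y∉xs x∈xs (sym x≡y)) (x ≟ y))
            (∑-⟦≟⟧-Unique _≟_ xs! x∈xs)

infix 4 _≐?_
_≐?_ : (F G : Fin n → Fin m) → Dec (F ≗ G)
F ≐? G = all? λ x → F x ≟ G x

∑-⟦≐⟧-allFuns : ∀ n m (F : Fin n → Fin m) → ∑[ G ∈ allFuns n m ] ⟦ F ≐? G ⟧ ≡ 1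
∑-⟦≐⟧-allFuns zero    m F = ⟦⟧-yes (λ ()) (F ≐? λ ())
∑-⟦≐⟧-allFuns (suc n) m F = begin
  ∑[ G ∈ allFuns (suc n) m ] ⟦ F ≐? G ⟧
    ≡⟨ ∑-concatMap extensions (allFuns n m) _ ⟩
  ∑[ G ∈ allFuns n m ] ∑ (extensions G) (λ G′ → ⟦ F ≐? G′ ⟧)
    ≡⟨ ∑-cong (allFuns n m) (λ G → trans (∑-map (_∷ᶠ G) (allFin m) _) (∑-cong (allFin m) (split G))) ⟩
  ∑[ G ∈ allFuns n m ] ∑[ y ∈ allFin m ] ⟦ F zero ≟ y ⟧ * ⟦ F ∘ suc ≐? G ⟧
    ≡⟨ ∑-cong (allFuns n m) (λ G → sym (∑-*ʳ _ (allFin m) _)) ⟩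
  ∑[ G ∈ allFuns n m ] (∑[ y ∈ allFin m ] ⟦ F zero ≟ y ⟧) * ⟦ F ∘ suc ≐? G ⟧
    ≡⟨ ∑-cong (allFuns n m) (λ G → trans (cong (_* ⟦ F ∘ suc ≐? G ⟧) F₀-once) (ℕ.*-identityˡ _)) ⟩
  ∑[ G ∈ allFuns n m ] ⟦ F ∘ suc ≐? G ⟧
    ≡⟨ ∑-⟦≐⟧-allFuns n m (F ∘ suc) ⟩
  1 ∎
  where
  open ≡-Reasoning
  extensions : (Fin n → Fin m) → List (Fin (suc n) → Fin m)
  extensions G = map (_∷ᶠ G) (allFin m)
  split : ∀ (G : Fin n → Fin m) y → ⟦ F ≐? (y ∷ᶠ G) ⟧ ≡ ⟦ F zero ≟ y ⟧ * ⟦ F ∘ suc ≐? G ⟧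
  split G y = trans
    (⟦⟧-cong (λ F≗y∷G → F≗y∷G zero , F≗y∷G ∘ suc)
             (λ { (F₀≡y , F₊≗G) → λ { zero → F₀≡y ; (suc i) → F₊≗G i } })
             (F ≐? (y ∷ᶠ G)) ((F zero ≟ y) ×-dec (F ∘ suc ≐? G)))
    (⟦⟧-× (F zero ≟ y) (F ∘ suc ≐? G))
  F₀-once : ∑[ y ∈ allFin m ] ⟦ F zero ≟ y ⟧ ≡ 1
  F₀-once = ∑-⟦≟⟧-Unique _≟_ (allFin⁺ m) (∈-allFin (F zero))

∑-⟦⟧-allFuns-unique : ∀ {P : Pred (Fin n → Fin m) 0ℓ} (P? : U.Decidable P) (F : Fin n → Fin m) →
                      (∀ {G} → P G → F ≗ G) → (∀ {G} → F ≗ G → P G) →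
                      ∑[ G ∈ allFuns n m ] ⟦ P? G ⟧ ≡ 1
∑-⟦⟧-allFuns-unique {n} {m} P? F P⇒≗ ≗⇒P =
  trans (∑-cong (allFuns n m) λ G → ⟦⟧-cong P⇒≗ ≗⇒P (P? G) (F ≐? G)) (∑-⟦≐⟧-allFuns n m F)

-- Image factorisations

Im : (B → A) → Pred A 0ℓ
Im f y = ∃ λ x → f x ≡ y

Onto : (B → A) → Set
Onto f = ∀ y → Im f y

Im-⊆-factorisation : ∀ {f : B → A} {g : B → C} {a : C → A} {g′ : B → D} {a′ : D → A} →
                     Onto g → a ∘ g ≗ f → a′ ∘ g′ ≗ f → Im a ⊆ Im a′
Im-⊆-factorisation {g′ = g′} g-onto a∘g≗f a′∘g′≗f (i , refl) with g-onto i
... | x , refl = g′ x , trans (a′∘g′≗f x) (sym (a∘g≗f x))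

Im-⊆⇒≤ : ∀ {a : Fin r → A} {a′ : Fin r′ → A} → Injective _≡_ _≡_ a → Im a ⊆ Im a′ → r ≤ r′
Im-⊆⇒≤ {a = a} {a′} a-inj a⊆a′ = injective⇒≤ {f = proj₁ ∘ a⊆a′ ∘ (_, refl)} λ {i} {j} eq →
  a-inj (trans (sym (proj₂ (a⊆a′ (i , refl)))) (trans (cong a′ eq) (proj₂ (a⊆a′ (j , refl)))))

onto⇒≤ : {g : Fin n → Fin r} → Onto g → r ≤ n
onto⇒≤ g-onto = Im-⊆⇒≤ (λ eq → eq) λ { (y , refl) → g-onto y }

module _ {a : Fin k → Fin N} (a↑ : StrictlyIncreasing a) where

  increasing⇒injective : Injective _≡_ _≡_ a
  increasing⇒injective {i} {j} aᵢ≡aⱼ with <-cmp i j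
  ... | tri< i<j _ _ = contradiction aᵢ≡aⱼ (<⇒≢ (a↑ i j i<j))
  ... | tri≈ _ i≡j _ = i≡j
  ... | tri> _ _ j<i = contradiction (sym aᵢ≡aⱼ) (<⇒≢ (a↑ j i j<i))

  increasing-reflects-< : ∀ {i j} → a i < a j → i < j
  increasing-reflects-< {i} {j} aᵢ<aⱼ with <-cmp i j
  ... | tri< i<j _ _  = i<j
  ... | tri≈ _ refl _ = contradiction aᵢ<aⱼ (<-irrefl refl)
  ... | tri> _ _ j<i  = contradiction aᵢ<aⱼ (<-asym (a↑ j i j<i))

increasing-least : ∀ {a : Fin (suc k) → Fin N} → StrictlyIncreasing a → ∀ i → a zero Fin.≤ a i
increasing-least a↑ zero    = ≤-refl
increasing-least a↑ (suc i) = ℕ.<⇒≤ (a↑ zero (suc i) z<s)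

Im-tail : ∀ {a b : Fin (suc k) → Fin N} → Injective _≡_ _≡_ a → a zero ≡ b zero →
          Im a ⊆ Im b → Im (a ∘ suc) ⊆ Im (b ∘ suc)
Im-tail a-inj a₀≡b₀ a⊆b (i , refl) with a⊆b (suc i , refl)
... | zero  , b₀≡aᵢ₊₁   = contradiction (a-inj (trans a₀≡b₀ b₀≡aᵢ₊₁)) 0≢1+n
... | suc j , bⱼ₊₁≡aᵢ₊₁ = j , bⱼ₊₁≡aᵢ₊₁

increasing-unique : ∀ {a b : Fin k → Fin N} → StrictlyIncreasing a → StrictlyIncreasing b →
                    Im a ⊆ Im b → Im b ⊆ Im a → a ≗ b
increasing-unique {zero}            a↑ b↑ a⊆b b⊆a ()
increasing-unique {suc k} {a = a} {b} a↑ b↑ a⊆b b⊆a = λ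
  { zero    → a₀≡b₀
  ; (suc i) → increasing-unique (tail↑ a↑) (tail↑ b↑)
                (Im-tail (increasing⇒injective a↑) a₀≡b₀ a⊆b)
                (Im-tail (increasing⇒injective b↑) (sym a₀≡b₀) b⊆a) i
  }
  where
  tail↑ : ∀ {a : Fin (suc k) → Fin N} → StrictlyIncreasing a → StrictlyIncreasing (a ∘ suc)
  tail↑ a↑ i j i<j = a↑ (suc i) (suc j) (s<s i<j)
  least-below : ∀ {a b : Fin (suc k) → Fin N} → StrictlyIncreasing a → Im b ⊆ Im a → a zero Fin.≤ b zero
  least-below a↑ b⊆a with b⊆a (zero , refl)
  ... | i , aᵢ≡b₀ = subst (_ Fin.≤_) aᵢ≡b₀ (increasing-least a↑ i)
  a₀≡b₀ : a zero ≡ b zero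
  a₀≡b₀ = ≤-antisym (least-below a↑ b⊆a) (least-below b↑ a⊆b)

EpiMono : (Fin n → Fin r) → (Fin r → Fin N) → Set
EpiMono g a = Onto g × StrictlyIncreasing a

record ImageFactorisation (f : Fin n → Fin N) : Set where
  field
    rank       : ℕ
    epi        : Fin n → Fin rank
    mono       : Fin rank → Fin N
    epiMono    : EpiMono epi mono
    factorises : mono ∘ epi ≗ f

lookup-AllPairs : ∀ {R : Rel A 0ℓ} {xs : List A} → AllPairs R xs → ∀ i j → i < j → R (lookup xs i) (lookup xs j)
lookup-AllPairs (Rx ∷ _)   zero    (suc j) _         = All.lookup Rx (∈-lookup j)
lookup-AllPairs (_  ∷ Rxs) (suc i) (suc j) (s<s i<j) = lookup-AllPairs Rxs i j i<j

imageFactorisation : (f : Fin n → Fin N) → ImageFactorisation f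
imageFactorisation {N = N} f = record
  { rank       = length image
  ; epi        = epi
  ; mono       = lookup image
  ; epiMono    = epi-onto , mono↑
  ; factorises = λ x → sym (lookup-index (∈-image x))
  }
  where
  Im? : U.Decidable (Im f)
  Im? y = any? λ x → f x ≟ y
  image : List (Fin N)
  image = filter Im? (allFin N)
  mono↑ : StrictlyIncreasing (lookup image)
  mono↑ = lookup-AllPairs (AllPairs.filter⁺ Im? (AllPairs.tabulate⁺-< {R = _<_} (λ i<j → i<j)))
  ∈-image : ∀ x → f x ∈ image
  ∈-image x = ∈-filter⁺ Im? (∈-allFin (f x)) (x , refl)
  epi : _ → Fin (length image)
  epi x = index (∈-image x)
  epi-onto : Onto epi
  epi-onto i with ∈-filter⁻ Im? {xs = allFin N} (∈-lookup i)
  ... | _ , x , fx≡yᵢ = x , increasing⇒injective mono↑ (trans (sym (lookup-index (∈-image x))) fx≡yᵢ)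

module _ {f : Fin n → Fin N} {g : Fin n → Fin r} {a : Fin r → Fin N} where

  rank-unique : ∀ {g′ : Fin n → Fin r′} {a′} → EpiMono g a → EpiMono g′ a′ →
                a ∘ g ≗ f → a′ ∘ g′ ≗ f → r ≡ r′
  rank-unique {g′ = g′} {a′ = a′} (g-onto , a↑) (g′-onto , a′↑) a∘g≗f a′∘g′≗f = ℕ.≤-antisym
    (Im-⊆⇒≤ (increasing⇒injective a↑) (Im-⊆-factorisation {g′ = g′} {a′} g-onto a∘g≗f a′∘g′≗f))
    (Im-⊆⇒≤ (increasing⇒injective a′↑) (Im-⊆-factorisation {g′ = g} {a} g′-onto a′∘g′≗f a∘g≗f))

  epiMono-unique : ∀ {g′ : Fin n → Fin r} {a′} → EpiMono g a → EpiMono g′ a′ →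
                   a ∘ g ≗ f → a′ ∘ g′ ≗ f → a ≗ a′ × g ≗ g′
  epiMono-unique {g′ = g′} {a′ = a′} (g-onto , a↑) (g′-onto , a′↑) a∘g≗f a′∘g′≗f =
    a≗a′ , g≗g′
    where
    a≗a′ : a ≗ a′
    a≗a′ = increasing-unique a↑ a′↑
      (Im-⊆-factorisation g-onto a∘g≗f a′∘g′≗f) (Im-⊆-factorisation g′-onto a′∘g′≗f a∘g≗f)
    g≗g′ : g ≗ g′
    g≗g′ x = increasing⇒injective a′↑
      (trans (sym (a≗a′ (g x))) (trans (a∘g≗f x) (sym (a′∘g′≗f x))))

-- Standardisation

injective⇒onto : {s : Fin k → Fin k} → Injective _≡_ _≡_ s → Onto s
injective⇒onto {zero}      s-inj ()
injective⇒onto {suc k} {s} s-inj y with any? (λ x → s x ≟ y)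
... | yes y∈Im = y∈Im
... | no  y∉Im = contradiction (injective⇒≤ squeeze-injective) ℕ.1+n≰n
  where
  y≢s : ∀ x → y ≢ s x
  y≢s x y≡sx = y∉Im (x , sym y≡sx)
  squeeze-injective : Injective _≡_ _≡_ (λ x → punchOut (y≢s x))
  squeeze-injective eq = s-inj (punchOut-injective (y≢s _) (y≢s _) eq)

-- StdIs Π a σ unfolds to SameOrder (proj₁ σ) (proj₁ Π ∘ a).
SameOrder : (Fin k → Fin m) → (Fin k → Fin N) → Set
SameOrder s h = ∀ i j → (s i < s j → h i < h j) × (h i < h j → s i < s j)

sameOrder? : (s : Fin k → Fin m) (h : Fin k → Fin N) → Dec (SameOrder s h)
sameOrder? s h = all? λ i → all? λ j →
  ((s i <? s j) →-dec (h i <? h j)) ×-dec ((h i <? h j) →-dec (s i <? s j))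

sameOrder-resp : ∀ {s s′ : Fin k → Fin m} {h : Fin k → Fin N} → s ≗ s′ → SameOrder s h → SameOrder s′ h
sameOrder-resp s≗s′ s~h i j =
  (λ s′ᵢ<s′ⱼ → proj₁ (s~h i j) (subst₂ _<_ (sym (s≗s′ i)) (sym (s≗s′ j)) s′ᵢ<s′ⱼ)) ,
  (λ hᵢ<hⱼ → subst₂ _<_ (s≗s′ i) (s≗s′ j) (proj₂ (s~h i j) hᵢ<hⱼ))

sameOrder-injective : ∀ {s : Fin k → Fin m} {h : Fin k → Fin N} →
                      Injective _≡_ _≡_ h → SameOrder s h → Injective _≡_ _≡_ s
sameOrder-injective {h = h} h-inj s~h {i} {j} sᵢ≡sⱼ with <-cmp (h i) (h j)
... | tri< hᵢ<hⱼ _ _ = contradiction sᵢ≡sⱼ (<⇒≢ (proj₂ (s~h i j) hᵢ<hⱼ))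
... | tri≈ _ hᵢ≡hⱼ _ = h-inj hᵢ≡hⱼ
... | tri> _ _ hⱼ<hᵢ = contradiction (sym sᵢ≡sⱼ) (<⇒≢ (proj₂ (s~h j i) hⱼ<hᵢ))

factorisation⇒sameOrder : ∀ {g : Fin k → Fin r} {a : Fin r → Fin N} {h : Fin k → Fin N} →
                          StrictlyIncreasing a → a ∘ g ≗ h → SameOrder g h
factorisation⇒sameOrder a↑ a∘g≗h i j =
  (λ gᵢ<gⱼ → subst₂ _<_ (a∘g≗h i) (a∘g≗h j) (a↑ _ _ gᵢ<gⱼ)) ,
  (λ hᵢ<hⱼ → increasing-reflects-< a↑ (subst₂ _<_ (sym (a∘g≗h i)) (sym (a∘g≗h j)) hᵢ<hⱼ))

sameOrder⇒factorisation : ∀ {s : Fin k → Fin k} {h : Fin k → Fin N} → Injective _≡_ _≡_ h → SameOrder s h →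
                          ∃ λ b → EpiMono s b × b ∘ s ≗ h
sameOrder⇒factorisation {s = s} {h} h-inj s~h = h ∘ s⁻¹ , (s-onto , b↑) , b∘s≗h
  where
  s-inj = sameOrder-injective h-inj s~h
  s-onto = injective⇒onto s-inj
  s⁻¹ = proj₁ ∘ s-onto
  b↑ : StrictlyIncreasing (h ∘ s⁻¹)
  b↑ y y′ y<y′ = proj₁ (s~h _ _) (subst₂ _<_ (sym (proj₂ (s-onto y))) (sym (proj₂ (s-onto y′))) y<y′)
  b∘s≗h : h ∘ s⁻¹ ∘ s ≗ h
  b∘s≗h x = cong h (s-inj (proj₂ (s-onto (s x))))

sameOrder-unique : ∀ {s s′ : Fin k → Fin k} {h : Fin k → Fin N} → Injective _≡_ _≡_ h →
                   SameOrder s h → SameOrder s′ h → s ≗ s′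
sameOrder-unique h-inj s~h s′~h with sameOrder⇒factorisation h-inj s~h | sameOrder⇒factorisation h-inj s′~h
... | _ , s/b , b∘s≗h | _ , s′/b′ , b′∘s′≗h = proj₂ (epiMono-unique s/b s′/b′ b∘s≗h b′∘s′≗h)

injective-factor : ∀ {g : B → C} {a : C → A} {h : B → A} →
                   a ∘ g ≗ h → Injective _≡_ _≡_ h → Injective _≡_ _≡_ g
injective-factor {a = a} a∘g≗h h-inj {x} {y} gx≡gy =
  h-inj (trans (sym (a∘g≗h x)) (trans (cong a gx≡gy) (a∘g≗h y)))

standardisation : ∀ {h : Fin k → Fin N} → Injective _≡_ _≡_ h → ∃ λ (s : Fin k → Fin k) → SameOrder s h
standardisation {k} {h = h} h-inj = from (imageFactorisation h)
  where
  from : ImageFactorisation h → ∃ λ (s : Fin k → Fin k) → SameOrder s h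
  from record { epi = g ; mono = a ; epiMono = g-onto , a↑ ; factorises = a∘g≗h }
    with ℕ.≤-antisym (onto⇒≤ g-onto) (injective⇒≤ (injective-factor {a = a} a∘g≗h h-inj))
  ... | refl = g , factorisation⇒sameOrder a↑ a∘g≗h

-- Counting patterns and factorisations

∑-perms : ∀ {P : Pred (Fin k → Fin k) 0ℓ} (P? : U.Decidable P) → (∀ {s} → P s → Injective _≡_ _≡_ s) →
          ∑[ σ ∈ perms k ] ⟦ P? (proj₁ σ) ⟧ ≡ ∑[ s ∈ allFuns k k ] ⟦ P? s ⟧
∑-perms {k} P? P⇒injective = trans (∑-concatMap (pickOf refl) (allFuns k k) _) (∑-cong (allFuns k k) ∑-pick)
  where
  -- perms concatMaps a selection function local to its definition; pickOf recovers it by unification.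
  pickOf : ∀ {pick} → perms k ≡ concatMap pick (allFuns k k) → (Fin k → Fin k) → List (Perm k)
  pickOf {pick} _ = pick
  ∑-pick : ∀ s → ∑[ σ ∈ pickOf refl s ] ⟦ P? (proj₁ σ) ⟧ ≡ ⟦ P? s ⟧
  ∑-pick s with injective? s
  ... | yes _   = ℕ.+-identityʳ _
  ... | no ¬inj = sym (⟦⟧-no (¬inj ∘ P⇒injective) (P? s))

∑-perms-sameOrder : ∀ {h : Fin k → Fin N} → Injective _≡_ _≡_ h →
                    ∑[ σ ∈ perms k ] ⟦ sameOrder? (proj₁ σ) h ⟧ ≡ 1
∑-perms-sameOrder {h = h} h-inj with standardisation h-inj
... | s , s~h = trans (∑-perms (λ s′ → sameOrder? s′ h) (sameOrder-injective h-inj))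
                      (∑-⟦⟧-allFuns-unique _ s (sameOrder-unique h-inj s~h) (λ s≗s′ → sameOrder-resp s≗s′ s~h))

onto? : (g : Fin n → Fin r) → Dec (Onto g)
onto? g = all? λ y → any? λ x → g x ≟ y

increasing? : (a : Fin r → Fin N) → Dec (StrictlyIncreasing a)
increasing? a = all? λ i → all? λ j → (i <? j) →-dec (a i <? a j)

epiMono? : (g : Fin n → Fin r) (a : Fin r → Fin N) → Dec (EpiMono g a)
epiMono? g a = onto? g ×-dec increasing? a

epiMono-resp : ∀ {g g′ : Fin n → Fin r} {a a′ : Fin r → Fin N} →
               g ≗ g′ → a ≗ a′ → EpiMono g a → EpiMono g′ a′
epiMono-resp g≗g′ a≗a′ (g-onto , a↑) =
  (λ y → proj₁ (g-onto y) , trans (sym (g≗g′ _)) (proj₂ (g-onto y))) ,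
  (λ i j i<j → subst₂ _<_ (a≗a′ i) (a≗a′ j) (a↑ i j i<j))

#Factorisations : (f : Fin n → Fin N) → ℕ → ℕ
#Factorisations {n} {N} f r = ∑[ g ∈ allFuns n r ] ∑[ a ∈ allFuns r N ] ⟦ epiMono? g a ⟧ * ⟦ a ∘ g ≐? f ⟧

module _ (f : Fin n → Fin N) where
  open ImageFactorisation (imageFactorisation f)

  #Factorisations≡⟦rank≟⟧ : ∀ r (rank≟r : Dec (rank ≡ r)) → #Factorisations f r ≡ ⟦ rank≟r ⟧
  #Factorisations≡⟦rank≟⟧ r (no rank≢r) =
    ∑-zero (All.universal (λ g → ∑-zero (All.universal (λ a → not-through g a) (allFuns r N))) (allFuns n r))
    where
    not-through : ∀ g a → ⟦ epiMono? g a ⟧ * ⟦ a ∘ g ≐? f ⟧ ≡ 0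
    not-through g a = trans (sym (⟦⟧-× (epiMono? g a) (a ∘ g ≐? f)))
      (⟦⟧-no (λ (g/a , a∘g≗f) → rank≢r (rank-unique epiMono g/a factorises a∘g≗f)) _)
  #Factorisations≡⟦rank≟⟧ r (yes refl) = begin
    #Factorisations f rank
      ≡⟨ ∑-cong (allFuns n rank) (λ g → ∑-cong (allFuns rank N) (through g)) ⟩
    ∑[ g ∈ allFuns n rank ] ∑[ a ∈ allFuns rank N ] ⟦ epi ≐? g ⟧ * ⟦ mono ≐? a ⟧
      ≡⟨ ∑-*-∑ (allFuns n rank) (allFuns rank N) _ _ ⟨
    (∑[ g ∈ allFuns n rank ] ⟦ epi ≐? g ⟧) * (∑[ a ∈ allFuns rank N ] ⟦ mono ≐? a ⟧)
      ≡⟨ cong₂ _*_ (∑-⟦≐⟧-allFuns n rank epi) (∑-⟦≐⟧-allFuns rank N mono) ⟩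
    1 ∎
    where
    open ≡-Reasoning
    through : ∀ g a → ⟦ epiMono? g a ⟧ * ⟦ a ∘ g ≐? f ⟧ ≡ ⟦ epi ≐? g ⟧ * ⟦ mono ≐? a ⟧
    through g a = begin
      ⟦ epiMono? g a ⟧ * ⟦ a ∘ g ≐? f ⟧   ≡⟨ ⟦⟧-× (epiMono? g a) (a ∘ g ≐? f) ⟨
      ⟦ epiMono? g a ×-dec a ∘ g ≐? f ⟧   ≡⟨ ⟦⟧-cong to from _ ((epi ≐? g) ×-dec (mono ≐? a)) ⟩
      ⟦ (epi ≐? g) ×-dec (mono ≐? a) ⟧    ≡⟨ ⟦⟧-× (epi ≐? g) (mono ≐? a) ⟩
      ⟦ epi ≐? g ⟧ * ⟦ mono ≐? a ⟧        ∎
      where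
      to : EpiMono g a × a ∘ g ≗ f → epi ≗ g × mono ≗ a
      to (g/a , a∘g≗f) = swap (epiMono-unique epiMono g/a factorises a∘g≗f)
      from : epi ≗ g × mono ≗ a → EpiMono g a × a ∘ g ≗ f
      from (epi≗g , mono≗a) = epiMono-resp epi≗g mono≗a epiMono ,
        λ x → trans (sym (mono≗a (g x))) (trans (cong mono (sym (epi≗g x))) (factorises x))

  ∑-#Factorisations : ∀ {K} → n ≤ K → ∑[ r ∈ upTo (suc K) ] #Factorisations f r ≡ 1
  ∑-#Factorisations {K} n≤K =
    trans (∑-cong (upTo (suc K)) λ r → #Factorisations≡⟦rank≟⟧ r (rank ℕ.≟ r))
          (∑-⟦≟⟧-Unique ℕ._≟_ (upTo⁺ (suc K)) (∈-upTo⁺ (s≤s rank≤K)))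
    where
    rank≤K : rank ≤ K
    rank≤K = ℕ.≤-trans (onto⇒≤ (proj₁ epiMono)) n≤K

module _ (w : (Fin n → Fin N) → ℕ) (w-resp : ∀ {f f′} → f ≗ f′ → w f′ ≡ w f) where

  ∑-*-#Factorisations : ∀ r → ∑[ f ∈ allFuns n N ] w f * #Factorisations f r ≡
                              ∑[ g ∈ allFuns n r ] ∑[ a ∈ allFuns r N ] ⟦ epiMono? g a ⟧ * w (a ∘ g)
  ∑-*-#Factorisations r = begin
    ∑[ f ∈ Fs ] w f * #Factorisations f r
      ≡⟨ ∑-cong Fs (λ f → trans (∑-*ˡ (w f) Gs _) (∑-cong Gs λ g → ∑-*ˡ (w f) As _)) ⟩
    ∑[ f ∈ Fs ] ∑[ g ∈ Gs ] ∑[ a ∈ As ] w f * (⟦ epiMono? g a ⟧ * ⟦ a ∘ g ≐? f ⟧)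
      ≡⟨ ∑-comm₃ Fs Gs As _ ⟩
    ∑[ g ∈ Gs ] ∑[ a ∈ As ] ∑[ f ∈ Fs ] w f * (⟦ epiMono? g a ⟧ * ⟦ a ∘ g ≐? f ⟧)
      ≡⟨ ∑-cong Gs (λ g → ∑-cong As λ a →
           trans (∑-cong Fs λ f → rearrange (w f) ⟦ epiMono? g a ⟧ ⟦ a ∘ g ≐? f ⟧)
                 (sym (∑-*ˡ ⟦ epiMono? g a ⟧ Fs _))) ⟩
    ∑[ g ∈ Gs ] ∑[ a ∈ As ] ⟦ epiMono? g a ⟧ * (∑[ f ∈ Fs ] ⟦ a ∘ g ≐? f ⟧ * w f)
      ≡⟨ ∑-cong Gs (λ g → ∑-cong As λ a →
           cong (⟦ epiMono? g a ⟧ *_) (∑-sift _≐?_ Fs w w-resp (∑-⟦≐⟧-allFuns n N (a ∘ g)))) ⟩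
    ∑[ g ∈ Gs ] ∑[ a ∈ As ] ⟦ epiMono? g a ⟧ * w (a ∘ g) ∎
    where
    open ≡-Reasoning
    Fs = allFuns n N
    Gs = allFuns n r
    As = allFuns r N
    rearrange : ∀ x y z → x * (y * z) ≡ y * (z * x)
    rearrange x y z = trans (ℕ.*-comm x (y * z)) (ℕ.*-assoc y z x)

  ∑-by-factorisation : ∀ {K} → n ≤ K → ∑[ f ∈ allFuns n N ] w f ≡
    ∑[ r ∈ upTo (suc K) ] ∑[ g ∈ allFuns n r ] ∑[ a ∈ allFuns r N ] ⟦ epiMono? g a ⟧ * w (a ∘ g)
  ∑-by-factorisation {K} n≤K = begin
    ∑[ f ∈ Fs ] w f
      ≡⟨ ∑-cong Fs (λ f → trans (sym (ℕ.*-identityʳ (w f)))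
                                (cong (w f *_) (sym (∑-#Factorisations f n≤K)))) ⟩
    ∑[ f ∈ Fs ] w f * (∑[ r ∈ Rs ] #Factorisations f r)
      ≡⟨ ∑-cong Fs (λ f → ∑-*ˡ (w f) Rs _) ⟩
    ∑[ f ∈ Fs ] ∑[ r ∈ Rs ] w f * #Factorisations f r
      ≡⟨ ∑-comm Fs Rs _ ⟩
    ∑[ r ∈ Rs ] ∑[ f ∈ Fs ] w f * #Factorisations f r
      ≡⟨ ∑-cong Rs ∑-*-#Factorisations ⟩
    ∑[ r ∈ Rs ] ∑[ g ∈ allFuns n r ] ∑[ a ∈ allFuns r N ] ⟦ epiMono? g a ⟧ * w (a ∘ g) ∎
    where
    open ≡-Reasoning
    Fs = allFuns n N
    Rs = upTo (suc K)

-- Morphisms into ι Π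

isMorphism-resp : ∀ {d e} {f f′ : Fin (size d) → Fin (size e)} →
                  f ≗ f′ → IsMorphism d e f → IsMorphism d e f′
isMorphism-resp {e = e} f≗f′ (P-preserved , Q-preserved) =
  (λ x y → subst₂ (P e) (f≗f′ x) (f≗f′ y) ∘ P-preserved x y) ,
  (λ x y → subst₂ (Q e) (f≗f′ x) (f≗f′ y) ∘ Q-preserved x y)

module Counting (d : DoublePoset) {N} (Π : Perm N) where

  private
    π = proj₁ Π

  mor : (Fin (size d) → Fin N) → ℕ
  mor f = ⟦ isMorphism? d (ι Π) f ⟧

  mor-resp : ∀ {f f′} → f ≗ f′ → mor f′ ≡ mor f
  mor-resp f≗f′ = ⟦⟧-cong (isMorphism-resp {d} {ι Π} (sym ∘ f≗f′)) (isMorphism-resp {d} {ι Π} f≗f′) _ _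

  module _ {k} (σ : Perm k) (g : Fin (size d) → Fin k) (a : Fin k → Fin N) where

    epi×occurrence⇒ : IsEpi d (ι σ) g × IsOccurrence Π σ a →
                      SameOrder (proj₁ σ) (π ∘ a) × EpiMono g a × IsMorphism d (ι Π) (a ∘ g)
    epi×occurrence⇒ (((P-preserved , Q-preserved) , g-onto) , a↑ , σ~πa) =
      σ~πa , (g-onto , a↑) ,
      (λ x y → a↑ _ _ ∘ P-preserved x y) , (λ x y → proj₁ (σ~πa _ _) ∘ Q-preserved x y)

    epi×occurrence⇐ : SameOrder (proj₁ σ) (π ∘ a) × EpiMono g a × IsMorphism d (ι Π) (a ∘ g) →
                      IsEpi d (ι σ) g × IsOccurrence Π σ a
    epi×occurrence⇐ (σ~πa , (g-onto , a↑) , (P-preserved , Q-preserved)) =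
      (((λ x y → increasing-reflects-< a↑ ∘ P-preserved x y) ,
        (λ x y → proj₂ (σ~πa _ _) ∘ Q-preserved x y)) ,
       g-onto) ,
      a↑ , σ~πa

  ∑-epi×occurrence : ∀ {k} (g : Fin (size d) → Fin k) (a : Fin k → Fin N) →
    ∑[ σ ∈ perms k ] ⟦ isEpi? d (ι σ) g ⟧ * ⟦ isOccurrence? Π σ a ⟧ ≡ ⟦ epiMono? g a ⟧ * mor (a ∘ g)
  ∑-epi×occurrence {k} g a = begin
    ∑[ σ ∈ perms k ] ⟦ isEpi? d (ι σ) g ⟧ * ⟦ isOccurrence? Π σ a ⟧
      ≡⟨ ∑-cong (perms k) split ⟩
    ∑[ σ ∈ perms k ] ⟦ sameOrder? (proj₁ σ) (π ∘ a) ⟧ * (⟦ epiMono? g a ⟧ * mor (a ∘ g))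
      ≡⟨ ∑-*ʳ _ (perms k) _ ⟨
    (∑[ σ ∈ perms k ] ⟦ sameOrder? (proj₁ σ) (π ∘ a) ⟧) * (⟦ epiMono? g a ⟧ * mor (a ∘ g))
      ≡⟨ one-pattern ⟩
    ⟦ epiMono? g a ⟧ * mor (a ∘ g) ∎
    where
    open ≡-Reasoning
    split : ∀ σ → ⟦ isEpi? d (ι σ) g ⟧ * ⟦ isOccurrence? Π σ a ⟧ ≡
                  ⟦ sameOrder? (proj₁ σ) (π ∘ a) ⟧ * (⟦ epiMono? g a ⟧ * mor (a ∘ g))
    split σ = begin
      ⟦ isEpi? d (ι σ) g ⟧ * ⟦ isOccurrence? Π σ a ⟧
        ≡⟨ ⟦⟧-× (isEpi? d (ι σ) g) (isOccurrence? Π σ a) ⟨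
      ⟦ isEpi? d (ι σ) g ×-dec isOccurrence? Π σ a ⟧
        ≡⟨ ⟦⟧-cong (epi×occurrence⇒ σ g a) (epi×occurrence⇐ σ g a) _
                   (so? ×-dec epiMono? g a ×-dec mor?) ⟩
      ⟦ so? ×-dec epiMono? g a ×-dec mor? ⟧
        ≡⟨ trans (⟦⟧-× so? _) (cong (⟦ so? ⟧ *_) (⟦⟧-× (epiMono? g a) mor?)) ⟩
      ⟦ so? ⟧ * (⟦ epiMono? g a ⟧ * mor (a ∘ g)) ∎
      where
      so? = sameOrder? (proj₁ σ) (π ∘ a)
      mor? = isMorphism? d (ι Π) (a ∘ g)
    one-pattern : (∑[ σ ∈ perms k ] ⟦ sameOrder? (proj₁ σ) (π ∘ a) ⟧) * (⟦ epiMono? g a ⟧ * mor (a ∘ g))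
                  ≡ ⟦ epiMono? g a ⟧ * mor (a ∘ g)
    one-pattern with epiMono? g a
    ... | no _         = ℕ.*-zeroʳ (∑[ σ ∈ perms k ] ⟦ sameOrder? (proj₁ σ) (π ∘ a) ⟧)
    ... | yes (_ , a↑) =
      trans (cong (_* (1 * mor (a ∘ g))) (∑-perms-sameOrder (increasing⇒injective a↑ ∘ proj₂ Π)))
            (ℕ.*-identityˡ _)

  termsOfSize≡ : ∀ k → termsOfSize d Π k ≡
                       ∑[ g ∈ allFuns (size d) k ] ∑[ a ∈ allFuns k N ] ⟦ epiMono? g a ⟧ * mor (a ∘ g)
  termsOfSize≡ k = begin
    ∑[ σ ∈ perms k ] #Epi d (ι σ) * #Occ Π σ
      ≡⟨ ∑-cong (perms k) (λ σ → cong₂ _*_ (count≡∑ (isEpi? d (ι σ)) Gs)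
                                            (count≡∑ (isOccurrence? Π σ) As)) ⟩
    ∑[ σ ∈ perms k ] (∑[ g ∈ Gs ] ⟦ isEpi? d (ι σ) g ⟧) * (∑[ a ∈ As ] ⟦ isOccurrence? Π σ a ⟧)
      ≡⟨ ∑-cong (perms k) (λ σ → ∑-*-∑ Gs As _ _) ⟩
    ∑[ σ ∈ perms k ] ∑[ g ∈ Gs ] ∑[ a ∈ As ] ⟦ isEpi? d (ι σ) g ⟧ * ⟦ isOccurrence? Π σ a ⟧
      ≡⟨ ∑-comm₃ (perms k) Gs As _ ⟩
    ∑[ g ∈ Gs ] ∑[ a ∈ As ] ∑[ σ ∈ perms k ] ⟦ isEpi? d (ι σ) g ⟧ * ⟦ isOccurrence? Π σ a ⟧
      ≡⟨ ∑-cong Gs (λ g → ∑-cong As (∑-epi×occurrence g)) ⟩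
    ∑[ g ∈ Gs ] ∑[ a ∈ As ] ⟦ epiMono? g a ⟧ * mor (a ∘ g) ∎
    where
    open ≡-Reasoning
    Gs = allFuns (size d) k
    As = allFuns k N

proposition3p8 : (d : DoublePoset) (N : ℕ) (Π : Perm N) →
    ∃ λ K → ∀ K′ → K ≤ K′ → #Mor d (ι Π) ≡ partialSum d Π K′
proposition3p8 d N Π = size d , λ K d≤K → begin
  #Mor d (ι Π)
    ≡⟨ count≡∑ (isMorphism? d (ι Π)) (allFuns (size d) N) ⟩
  ∑[ f ∈ allFuns (size d) N ] mor f
    ≡⟨ ∑-by-factorisation mor mor-resp d≤K ⟩
  ∑[ k ∈ upTo (suc K) ] ∑[ g ∈ allFuns (size d) k ] ∑[ a ∈ allFuns k N ] ⟦ epiMono? g a ⟧ * mor (a ∘ g)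
    ≡⟨ ∑-cong (upTo (suc K)) (sym ∘ termsOfSize≡) ⟩
  partialSum d Π K ∎
  where
  open Counting d Π
  open ≡-Reasoning
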